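{- Let $n\ge 1$. Let $f_1,\dots,f_{2n}$ be the generators of $\mathfrak{e}_{C_{2n}}$ and $e_{\bar 1},e_1,e_2,\dots,e_{2n}$ the generators of $\mathfrak{e}_{D_{2n+1}}$. Then there is a Lie algebra homomorphism $\phi:\mathfrak{e}_{C_{2n}}\to\mathfrak{e}_{D_{2n+1}}$ with $\phi(f_1)=\tfrac{1}{2}(e_1+e_{\bar 1})$ and $\phi(f_k)=e_k$ for all $k\ge 2$.
   Context: All Lie algebras are over $\mathbb{C}$. $\mathfrak{e}_{C_{m}}$ is generated by $f_1,\dots,f_m$ subject to: $[f_i,f_j]=0$ if $|i-j|\ge 2$; $[f_i,[f_i,f_j]]=-2f_i$ if $|i-j|=1$ and $i\ne 1$; $[f_1,[f_1,[f_1,f_2]]]=0$. The Dynkin diagram $D_{m+1}$ ($m\ge 2$) has nodes $\bar 1,1,2,\dots,m$ with edges $\bar1-2$, $1-2$, and $i-(i+1)$ for $2\le i\le m-1$. $\mathfrak{e}_{D_{m+1}}$ is generated by $e_{\bar1},e_1,e_2,\dots,e_m$ subject to: $[e_a,[e_a,e_b]]=-2e_a$ whenever $a,b$ are adjacent nodes (in either order), and $[e_a,e_b]=0$ whenever $a\ne b$ are non-adjacent nodes. -}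

module Defs where

open import Level using (Level; _⊔_; 0ℓ)
open import Algebra.Bundles using (CommutativeRing)
open import Data.Nat using (ℕ; zero; suc; _≤_; ∣_-_∣)
open import Data.Fin using (Fin; toℕ)
open import Data.Maybe using (Maybe; nothing; just)
open import Data.Sum using (_⊎_)
open import Relation.Binary.PropositionalEquality using (_≡_)
open import Relation.Nullary using (¬_)

module Presented {c ℓ : Level} (K : CommutativeRing c ℓ) where
  open CommutativeRing K renaming (Carrier to S)

  infixl 6 _⊕_
  infixr 7 _·_

  data Tm (G : Set) : Set c where
    gen  : G → Tm G
    𝟎    : Tm G
    _⊕_  : Tm G → Tm G → Tm G
    _·_  : S → Tm G → Tm G
    ⟦_,_⟧ : Tm G → Tm G → Tm G

  -- the smallest congruence containing the Lie algebra axioms over K and the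
  -- given relations R; Tm G / ≈ is the Lie algebra presented by (G , R)
  data Eq {G : Set} (R : Tm G → Tm G → Set) : Tm G → Tm G → Set (c ⊔ ℓ) where
    refl′  : ∀ {x} → Eq R x x
    sym′   : ∀ {x y} → Eq R x y → Eq R y x
    trans′ : ∀ {x y z} → Eq R x y → Eq R y z → Eq R x z
    ⊕-cong : ∀ {x x′ y y′} → Eq R x x′ → Eq R y y′ → Eq R (x ⊕ y) (x′ ⊕ y′)
    ·-cong : ∀ {a b x y} → a ≈ b → Eq R x y → Eq R (a · x) (b · y)
    br-cong : ∀ {x x′ y y′} → Eq R x x′ → Eq R y y′ → Eq R ⟦ x , y ⟧ ⟦ x′ , y′ ⟧
    ⊕-assoc : ∀ {x y z} → Eq R ((x ⊕ y) ⊕ z) (x ⊕ (y ⊕ z))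
    ⊕-comm  : ∀ {x y} → Eq R (x ⊕ y) (y ⊕ x)
    ⊕-idˡ   : ∀ {x} → Eq R (𝟎 ⊕ x) x
    ⊕-invʳ  : ∀ {x} → Eq R (x ⊕ ((- 1#) · x)) 𝟎
    ·-assoc : ∀ {a b x} → Eq R (a · (b · x)) ((a * b) · x)
    ·-id    : ∀ {x} → Eq R (1# · x) x
    ·-distˡ : ∀ {a x y} → Eq R (a · (x ⊕ y)) (a · x ⊕ a · y)
    ·-distʳ : ∀ {a b x} → Eq R ((a + b) · x) (a · x ⊕ b · x)
    br-⊕ˡ : ∀ {x y z} → Eq R ⟦ x ⊕ y , z ⟧ (⟦ x , z ⟧ ⊕ ⟦ y , z ⟧)
    br-⊕ʳ : ∀ {x y z} → Eq R ⟦ x , y ⊕ z ⟧ (⟦ x , y ⟧ ⊕ ⟦ x , z ⟧)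
    br-·ˡ : ∀ {a x y} → Eq R ⟦ a · x , y ⟧ (a · ⟦ x , y ⟧)
    br-·ʳ : ∀ {a x y} → Eq R ⟦ x , a · y ⟧ (a · ⟦ x , y ⟧)
    br-alt : ∀ {x} → Eq R ⟦ x , x ⟧ 𝟎
    jacobi : ∀ {x y z} →
      Eq R (⟦ x , ⟦ y , z ⟧ ⟧ ⊕ ⟦ y , ⟦ z , x ⟧ ⟧ ⊕ ⟦ z , ⟦ x , y ⟧ ⟧) 𝟎
    rel : ∀ {x y} → R x y → Eq R x y

  record LieHom {G H : Set} (R : Tm G → Tm G → Set) (Q : Tm H → Tm H → Set)
         : Set (c ⊔ ℓ) where
    field
      map      : Tm G → Tm H
      map-cong : ∀ {x y} → Eq R x y → Eq Q (map x) (map y)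
      map-⊕    : ∀ x y → Eq Q (map (x ⊕ y)) (map x ⊕ map y)
      map-·    : ∀ a x → Eq Q (map (a · x)) (a · map x)
      map-br   : ∀ x y → Eq Q (map ⟦ x , y ⟧) ⟦ map x , map y ⟧

  minus2 : S
  minus2 = - (1# + 1#)

  dist : {m : ℕ} → Fin m → Fin m → ℕ
  dist i j = ∣ toℕ i - toℕ j ∣

  -- e_{C_m}: generators f_1..f_m, where (i : Fin m) stands for f_{toℕ i + 1}
  data CRel (m : ℕ) : Tm (Fin m) → Tm (Fin m) → Set where
    c-comm  : ∀ i j → 2 ≤ dist i j → CRel m ⟦ gen i , gen j ⟧ 𝟎
    c-serre : ∀ i j → dist i j ≡ 1 → ¬ (toℕ i ≡ 0) →
      CRel m ⟦ gen i , ⟦ gen i , gen j ⟧ ⟧ (minus2 · gen i)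
    c-top   : ∀ i j → toℕ i ≡ 0 → toℕ j ≡ 1 →
      CRel m ⟦ gen i , ⟦ gen i , ⟦ gen i , gen j ⟧ ⟧ ⟧ 𝟎

  -- nodes of D_{m+1}: nothing = node 1̄, just i = node (toℕ i + 1)
  Node : ℕ → Set
  Node m = Maybe (Fin m)

  -- edges 1̄ - 2 and i - (i+1) for 1 ≤ i ≤ m-1 (one orientation)
  data Edge (m : ℕ) : Node m → Node m → Set where
    bar-edge   : ∀ j → toℕ j ≡ 1 → Edge m nothing (just j)
    chain-edge : ∀ i j → dist i j ≡ 1 → Edge m (just i) (just j)

  Adj : (m : ℕ) → Node m → Node m → Set
  Adj m a b = Edge m a b ⊎ Edge m b a

  data DRel (m : ℕ) : Tm (Node m) → Tm (Node m) → Set where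
    d-serre : ∀ a b → Adj m a b →
      DRel m ⟦ gen a , ⟦ gen a , gen b ⟧ ⟧ (minus2 · gen a)
    d-comm  : ∀ a b → ¬ (a ≡ b) → ¬ Adj m a b → DRel m ⟦ gen a , gen b ⟧ 𝟎

-- Since e₁ and e_1̄ commute and each satisfies the sl₂-type Serre relation against e₂,
-- the average u = ½(e₁ + e_1̄) satisfies [e₂,[e₂,u]] = −2e₂ (both halves give −2e₂),
-- and ad(u)³e₂ = 0: ad(e₁ + e_1̄)²e₂ expands into four terms, each of which is
-- killed by ad e₁ and ad e_1̄, because ad e₁ and ad e_1̄ commute and
-- [e₁,[e₁,e₂]] = −2e₁, [e_1̄,[e_1̄,e₂]] = −2e_1̄ commute with both.  The remaining
-- relations of e_{C_m} follow termwise from defining relations of e_{D_{m+1}}.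
module Submission where

open import Defs
open import Level using (Level; _⊔_)
open import Algebra.Bundles using (CommutativeRing)
open import Data.Nat using (ℕ; _≤_; _*_; s≤s)
open import Data.Nat.Properties using (∣-∣-comm; ∣n-n∣≡0)
open import Data.Fin using (Fin; toℕ; zero; suc)
open import Data.Maybe using (nothing; just)
open import Data.Product using (Σ; _×_; _,_)
open import Data.Sum using (inj₁; inj₂)
open import Data.Empty using (⊥-elim)
open import Function using (_∘_)
open import Relation.Nullary using (¬_)
open import Relation.Binary.PropositionalEquality using (_≡_; refl; subst)
open import Relation.Binary.Bundles using (Setoid)
import Algebra.Properties.Ring as RingProperties
import Relation.Binary.Reasoning.Setoid as SetoidReasoning

module PresentedLieAlgebra {c ℓ : Level} (K : CommutativeRing c ℓ) where
  open CommutativeRing K using (_≈_; _+_; -_; 1#; ring)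
    renaming (Carrier to S; refl to ≈-refl; trans to ≈-trans)
  open Presented K

  module Substitution {G H : Set} {R : Tm G → Tm G → Set} {Q : Tm H → Tm H → Set}
                      (g : G → Tm H) where

    substitute : Tm G → Tm H
    substitute (gen i)     = g i
    substitute 𝟎           = 𝟎
    substitute (x ⊕ y)     = substitute x ⊕ substitute y
    substitute (a · x)     = a · substitute x
    substitute ⟦ x , y ⟧   = ⟦ substitute x , substitute y ⟧

    module _ (respects : ∀ {x y} → R x y → Eq Q (substitute x) (substitute y)) where

      substitute-cong : ∀ {x y} → Eq R x y → Eq Q (substitute x) (substitute y)
      substitute-cong refl′        = refl′
      substitute-cong (sym′ p)     = sym′ (substitute-cong p)
      substitute-cong (trans′ p q) = trans′ (substitute-cong p) (substitute-cong q)
      substitute-cong (⊕-cong p q) = ⊕-cong (substitute-cong p) (substitute-cong q)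
      substitute-cong (·-cong a p) = ·-cong a (substitute-cong p)
      substitute-cong (br-cong p q) = br-cong (substitute-cong p) (substitute-cong q)
      substitute-cong ⊕-assoc = ⊕-assoc
      substitute-cong ⊕-comm  = ⊕-comm
      substitute-cong ⊕-idˡ   = ⊕-idˡ
      substitute-cong ⊕-invʳ  = ⊕-invʳ
      substitute-cong ·-assoc = ·-assoc
      substitute-cong ·-id    = ·-id
      substitute-cong ·-distˡ = ·-distˡ
      substitute-cong ·-distʳ = ·-distʳ
      substitute-cong br-⊕ˡ   = br-⊕ˡ
      substitute-cong br-⊕ʳ   = br-⊕ʳ
      substitute-cong br-·ˡ   = br-·ˡ
      substitute-cong br-·ʳ   = br-·ʳ
      substitute-cong br-alt  = br-alt
      substitute-cong jacobi  = jacobi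
      substitute-cong (rel r) = respects r

      substitutionHom : LieHom R Q
      substitutionHom = record
        { map      = substitute
        ; map-cong = substitute-cong
        ; map-⊕    = λ _ _ → refl′
        ; map-·    = λ _ _ → refl′
        ; map-br   = λ _ _ → refl′
        }

  module Identities {G : Set} (R : Tm G → Tm G → Set) where
    open RingProperties ring using (-1*x≈-x; -‿involutive)

    setoid : Setoid c (c ⊔ ℓ)
    setoid = record
      { Carrier = Tm G ; _≈_ = Eq R
      ; isEquivalence = record { refl = refl′ ; sym = sym′ ; trans = trans′ } }
    open SetoidReasoning setoid

    _≋_ : Tm G → Tm G → Set (c ⊔ ℓ)
    _≋_ = Eq R

    ⊕-idʳ : ∀ {x} → (x ⊕ 𝟎) ≋ x
    ⊕-idʳ = trans′ ⊕-comm ⊕-idˡ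

    x≋x⊕x⇒x≋𝟎 : ∀ {x} → x ≋ (x ⊕ x) → x ≋ 𝟎
    x≋x⊕x⇒x≋𝟎 {x} p = sym′ (begin
      𝟎                     ≈⟨ sym′ ⊕-invʳ ⟩
      x ⊕ (- 1#) · x        ≈⟨ ⊕-cong p refl′ ⟩
      (x ⊕ x) ⊕ (- 1#) · x  ≈⟨ ⊕-assoc ⟩
      x ⊕ (x ⊕ (- 1#) · x)  ≈⟨ ⊕-cong refl′ ⊕-invʳ ⟩
      x ⊕ 𝟎                 ≈⟨ ⊕-idʳ ⟩
      x                     ∎)

    ·-zeroʳ : ∀ {a} → (a · 𝟎) ≋ 𝟎
    ·-zeroʳ = x≋x⊕x⇒x≋𝟎 (trans′ (·-cong ≈-refl (sym′ ⊕-idˡ)) ·-distˡ)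

    br-zeroʳ : ∀ {x} → ⟦ x , 𝟎 ⟧ ≋ 𝟎
    br-zeroʳ = x≋x⊕x⇒x≋𝟎 (trans′ (br-cong refl′ (sym′ ⊕-idˡ)) br-⊕ʳ)

    ⊕-zero : ∀ {x y} → x ≋ 𝟎 → y ≋ 𝟎 → (x ⊕ y) ≋ 𝟎
    ⊕-zero p q = trans′ (⊕-cong p q) ⊕-idˡ

    ·-zero : ∀ {a x} → x ≋ 𝟎 → (a · x) ≋ 𝟎
    ·-zero p = trans′ (·-cong ≈-refl p) ·-zeroʳ

    br-⊕ˡ-zero : ∀ {x y z} → ⟦ x , z ⟧ ≋ 𝟎 → ⟦ y , z ⟧ ≋ 𝟎 → ⟦ x ⊕ y , z ⟧ ≋ 𝟎
    br-⊕ˡ-zero p q = trans′ br-⊕ˡ (⊕-zero p q)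

    br-⊕ʳ-zero : ∀ {x y z} → ⟦ x , y ⟧ ≋ 𝟎 → ⟦ x , z ⟧ ≋ 𝟎 → ⟦ x , y ⊕ z ⟧ ≋ 𝟎
    br-⊕ʳ-zero p q = trans′ br-⊕ʳ (⊕-zero p q)

    br-·ʳ-zero : ∀ {a x y} → ⟦ x , y ⟧ ≋ 𝟎 → ⟦ x , a · y ⟧ ≋ 𝟎
    br-·ʳ-zero p = trans′ br-·ʳ (·-zero p)

    ⊕-inverse-unique : ∀ {x y} → (x ⊕ y) ≋ 𝟎 → y ≋ ((- 1#) · x)
    ⊕-inverse-unique {x} {y} e = begin
      y                       ≈⟨ sym′ ⊕-idˡ ⟩
      𝟎 ⊕ y                   ≈⟨ ⊕-cong (sym′ (trans′ ⊕-comm ⊕-invʳ)) refl′ ⟩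
      ((- 1#) · x ⊕ x) ⊕ y    ≈⟨ ⊕-assoc ⟩
      (- 1#) · x ⊕ (x ⊕ y)    ≈⟨ ⊕-cong refl′ e ⟩
      (- 1#) · x ⊕ 𝟎          ≈⟨ ⊕-idʳ ⟩
      (- 1#) · x              ∎

    br-antisym : ∀ {x y} → ⟦ y , x ⟧ ≋ ((- 1#) · ⟦ x , y ⟧)
    br-antisym {x} {y} = ⊕-inverse-unique (sym′ (begin
      𝟎                                                  ≈⟨ sym′ br-alt ⟩
      ⟦ x ⊕ y , x ⊕ y ⟧                                  ≈⟨ br-⊕ˡ ⟩
      ⟦ x , x ⊕ y ⟧ ⊕ ⟦ y , x ⊕ y ⟧                      ≈⟨ ⊕-cong br-⊕ʳ br-⊕ʳ ⟩
      (⟦ x , x ⟧ ⊕ ⟦ x , y ⟧) ⊕ (⟦ y , x ⟧ ⊕ ⟦ y , y ⟧)  ≈⟨ ⊕-cong (⊕-cong br-alt refl′) (⊕-cong refl′ br-alt) ⟩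
      (𝟎 ⊕ ⟦ x , y ⟧) ⊕ (⟦ y , x ⟧ ⊕ 𝟎)                  ≈⟨ ⊕-cong ⊕-idˡ ⊕-idʳ ⟩
      ⟦ x , y ⟧ ⊕ ⟦ y , x ⟧                              ∎))

    br-comm-zero : ∀ {x y} → ⟦ x , y ⟧ ≋ 𝟎 → ⟦ y , x ⟧ ≋ 𝟎
    br-comm-zero p = trans′ br-antisym (·-zero p)

    -1·-involutive : ∀ {x} → ((- 1#) · ((- 1#) · x)) ≋ x
    -1·-involutive = trans′ ·-assoc (trans′ (·-cong -1*-1≈1 refl′) ·-id)
      where -1*-1≈1 = ≈-trans (-1*x≈-x (- 1#)) (-‿involutive 1#)

    -- Jacobi: ad ⟦ x , y ⟧ = ad x ∘ ad y − ad y ∘ ad x.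
    ad-comm : ∀ {x y} → ⟦ x , y ⟧ ≋ 𝟎 → ∀ z → ⟦ x , ⟦ y , z ⟧ ⟧ ≋ ⟦ y , ⟦ x , z ⟧ ⟧
    ad-comm {x} {y} xy z = begin
      ⟦ x , ⟦ y , z ⟧ ⟧                        ≈⟨ ⊕-inverse-unique (trans′ ⊕-comm jacobi-xyz) ⟩
      (- 1#) · ⟦ y , ⟦ z , x ⟧ ⟧               ≈⟨ ·-cong ≈-refl (trans′ (br-cong refl′ br-antisym) br-·ʳ) ⟩
      (- 1#) · ((- 1#) · ⟦ y , ⟦ x , z ⟧ ⟧)    ≈⟨ -1·-involutive ⟩
      ⟦ y , ⟦ x , z ⟧ ⟧                        ∎
      where
      jacobi-xyz : (⟦ x , ⟦ y , z ⟧ ⟧ ⊕ ⟦ y , ⟦ z , x ⟧ ⟧) ≋ 𝟎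
      jacobi-xyz = begin
        ⟦ x , ⟦ y , z ⟧ ⟧ ⊕ ⟦ y , ⟦ z , x ⟧ ⟧          ≈⟨ sym′ ⊕-idʳ ⟩
        ⟦ x , ⟦ y , z ⟧ ⟧ ⊕ ⟦ y , ⟦ z , x ⟧ ⟧ ⊕ 𝟎      ≈⟨ ⊕-cong refl′ (sym′ (trans′ (br-cong refl′ xy) br-zeroʳ)) ⟩
        ⟦ x , ⟦ y , z ⟧ ⟧ ⊕ ⟦ y , ⟦ z , x ⟧ ⟧ ⊕ ⟦ z , ⟦ x , y ⟧ ⟧  ≈⟨ jacobi ⟩
        𝟎                                              ∎

    ad²-average : ∀ (h : S) → h + h ≈ 1# → ∀ {x y z w} →
      ⟦ z , ⟦ z , x ⟧ ⟧ ≋ w → ⟦ z , ⟦ z , y ⟧ ⟧ ≋ w → ⟦ z , ⟦ z , h · (x ⊕ y) ⟧ ⟧ ≋ w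
    ad²-average h h+h≈1 {x} {y} {z} {w} p q = begin
      ⟦ z , ⟦ z , h · (x ⊕ y) ⟧ ⟧                  ≈⟨ br-cong refl′ (trans′ br-·ʳ (·-cong ≈-refl br-⊕ʳ)) ⟩
      ⟦ z , h · (⟦ z , x ⟧ ⊕ ⟦ z , y ⟧) ⟧          ≈⟨ trans′ br-·ʳ (·-cong ≈-refl br-⊕ʳ) ⟩
      h · (⟦ z , ⟦ z , x ⟧ ⟧ ⊕ ⟦ z , ⟦ z , y ⟧ ⟧)  ≈⟨ ·-cong ≈-refl (⊕-cong p q) ⟩
      h · (w ⊕ w)                                  ≈⟨ ·-distˡ ⟩
      h · w ⊕ h · w                                ≈⟨ sym′ ·-distʳ ⟩
      (h + h) · w                                  ≈⟨ ·-cong h+h≈1 refl′ ⟩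
      1# · w                                       ≈⟨ ·-id ⟩
      w                                            ∎

    ad³-·-zero : ∀ (h : S) {u z} → ⟦ u , ⟦ u , ⟦ u , z ⟧ ⟧ ⟧ ≋ 𝟎 →
      ⟦ h · u , ⟦ h · u , ⟦ h · u , z ⟧ ⟧ ⟧ ≋ 𝟎
    ad³-·-zero h {u} {z} p = begin
      ⟦ h · u , ⟦ h · u , ⟦ h · u , z ⟧ ⟧ ⟧  ≈⟨ br-cong refl′ (br-cong refl′ br-·ˡ) ⟩
      ⟦ h · u , ⟦ h · u , h · ⟦ u , z ⟧ ⟧ ⟧  ≈⟨ br-cong refl′ (trans′ br-·ʳ (·-cong ≈-refl br-·ˡ)) ⟩
      ⟦ h · u , h · (h · ⟦ u , ⟦ u , z ⟧ ⟧) ⟧  ≈⟨ trans′ br-·ʳ (·-cong ≈-refl (trans′ br-·ʳ (·-cong ≈-refl br-·ˡ))) ⟩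
      h · (h · (h · ⟦ u , ⟦ u , ⟦ u , z ⟧ ⟧ ⟧))  ≈⟨ ·-zero (·-zero (·-zero p)) ⟩
      𝟎                                      ∎

    -- The hypotheses make ad x ∘ ad x and ad y ∘ ad y send z into the
    -- centraliser of {x , y}; commuting ad x past ad y handles the mixed terms.
    ad³-⊕-zero : ∀ {x y z} {s t : S} → ⟦ x , y ⟧ ≋ 𝟎 →
      ⟦ x , ⟦ x , z ⟧ ⟧ ≋ (s · x) → ⟦ y , ⟦ y , z ⟧ ⟧ ≋ (t · y) →
      ⟦ x ⊕ y , ⟦ x ⊕ y , ⟦ x ⊕ y , z ⟧ ⟧ ⟧ ≋ 𝟎
    ad³-⊕-zero {x} {y} {z} xy xxz yyz =
      trans′ (br-cong refl′ ad²-expand)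
        (br-⊕ʳ-zero (br-⊕ʳ-zero (br-⊕ˡ-zero x-xxz y-xxz) (br-⊕ˡ-zero x-yxz y-yxz))
                    (br-⊕ʳ-zero (br-⊕ˡ-zero x-xyz y-xyz) (br-⊕ˡ-zero x-yyz y-yyz)))
      where
      yx = br-comm-zero xy
      ad²-expand : ⟦ x ⊕ y , ⟦ x ⊕ y , z ⟧ ⟧ ≋
        ((⟦ x , ⟦ x , z ⟧ ⟧ ⊕ ⟦ y , ⟦ x , z ⟧ ⟧) ⊕ (⟦ x , ⟦ y , z ⟧ ⟧ ⊕ ⟦ y , ⟦ y , z ⟧ ⟧))
      ad²-expand = trans′ (br-cong refl′ br-⊕ˡ) (trans′ br-⊕ʳ (⊕-cong br-⊕ˡ br-⊕ˡ))
      x-xxz = trans′ (br-cong refl′ xxz) (br-·ʳ-zero br-alt)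
      y-xxz = trans′ (br-cong refl′ xxz) (br-·ʳ-zero yx)
      y-yyz = trans′ (br-cong refl′ yyz) (br-·ʳ-zero br-alt)
      x-yyz = trans′ (br-cong refl′ yyz) (br-·ʳ-zero xy)
      x-yxz = trans′ (ad-comm xy _) y-xxz
      y-xyz = trans′ (ad-comm yx _) x-yyz
      y-yxz = trans′ (br-cong refl′ (ad-comm yx _)) y-xyz
      x-xyz = trans′ (br-cong refl′ (ad-comm xy _)) x-yxz

module DynkinD {c ℓ : Level} (K : CommutativeRing c ℓ) (m : ℕ) where
  open Presented K
  open PresentedLieAlgebra.Identities K (DRel m) using (br-comm-zero)

  private
    2≰1 : ∀ {k} → 2 ≤ k → ¬ (k ≡ 1)
    2≰1 (s≤s ()) refl

  far-nodes-≢ : ∀ (i j : Fin m) → 2 ≤ dist i j → ¬ (just i ≡ just j)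
  far-nodes-≢ i .i d refl with subst (2 ≤_) (∣n-n∣≡0 (toℕ i)) d
  ... | ()

  far-nodes-¬adj : ∀ (i j : Fin m) → 2 ≤ dist i j → ¬ Adj m (just i) (just j)
  far-nodes-¬adj i j d (inj₁ (chain-edge _ _ e)) = 2≰1 d e
  far-nodes-¬adj i j d (inj₂ (chain-edge _ _ e)) =
    2≰1 d (subst (_≡ 1) (∣-∣-comm (toℕ j) (toℕ i)) e)

  bar-¬adj : ∀ (k : Fin m) → ¬ (toℕ k ≡ 1) → ¬ Adj m nothing (just k)
  bar-¬adj k k≢1 (inj₁ (bar-edge _ e)) = k≢1 e

  bracket-far-nodes : ∀ (i j : Fin m) → 2 ≤ dist i j →
    Eq (DRel m) ⟦ gen (just i) , gen (just j) ⟧ 𝟎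
  bracket-far-nodes i j d = rel (d-comm _ _ (far-nodes-≢ i j d) (far-nodes-¬adj i j d))

  bracket-bar : ∀ (k : Fin m) → ¬ (toℕ k ≡ 1) → Eq (DRel m) ⟦ gen nothing , gen (just k) ⟧ 𝟎
  bracket-bar k k≢1 = rel (d-comm _ _ (λ ()) (bar-¬adj k k≢1))

  bracket-bar-far : ∀ (k : Fin m) → 2 ≤ toℕ k → Eq (DRel m) ⟦ gen nothing , gen (just k) ⟧ 𝟎
  bracket-bar-far k d = bracket-bar k (2≰1 d)

  bracket-far-bar : ∀ (k : Fin m) → 2 ≤ toℕ k → Eq (DRel m) ⟦ gen (just k) , gen nothing ⟧ 𝟎
  bracket-far-bar k d = br-comm-zero (bracket-bar-far k d)

module Embedding {c ℓ : Level} (K : CommutativeRing c ℓ)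
  (half : CommutativeRing.Carrier K)
  (half+half≈1 : CommutativeRing._≈_ K (CommutativeRing._+_ K half half) (CommutativeRing.1# K))
  (m : ℕ) where
  open Presented K
  open PresentedLieAlgebra K
  open Identities (DRel m)
  open DynkinD K m

  image : Fin m → Tm (Node m)
  image zero    = half · (gen (just zero) ⊕ gen nothing)
  image (suc k) = gen (just (suc k))

  open Substitution {R = CRel m} {Q = DRel m} image

  serre : ∀ {a b} → Adj m a b → Eq (DRel m) ⟦ gen a , ⟦ gen a , gen b ⟧ ⟧ (minus2 · gen a)
  serre = rel ∘ d-serre _ _

  image-respects-CRel : ∀ {x y} → CRel m x y → Eq (DRel m) (substitute x) (substitute y)
  image-respects-CRel (c-comm zero zero ())
  image-respects-CRel (c-comm zero (suc k) d) = trans′ br-·ˡ (·-zero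
    (br-⊕ˡ-zero (bracket-far-nodes zero (suc k) d) (bracket-bar-far (suc k) d)))
  image-respects-CRel (c-comm (suc k) zero d) = br-·ʳ-zero
    (br-⊕ʳ-zero (bracket-far-nodes (suc k) zero d) (bracket-far-bar (suc k) d))
  image-respects-CRel (c-comm (suc i) (suc j) d) = bracket-far-nodes (suc i) (suc j) d
  image-respects-CRel (c-serre zero _ _ i≢0) = ⊥-elim (i≢0 refl)
  image-respects-CRel (c-serre (suc k) zero d _) = ad²-average half half+half≈1
    (serre (inj₁ (chain-edge (suc k) zero d))) (serre (inj₂ (bar-edge (suc k) d)))
  image-respects-CRel (c-serre (suc i) (suc j) d _) = serre (inj₁ (chain-edge (suc i) (suc j) d))
  image-respects-CRel (c-top (suc i) _ () _)
  image-respects-CRel (c-top zero zero _ ())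
  image-respects-CRel (c-top zero (suc k) _ k≡1) = ad³-·-zero half
    (ad³-⊕-zero (br-comm-zero (bracket-bar zero (λ ())))
      (serre (inj₁ (chain-edge zero (suc k) k≡1))) (serre (inj₁ (bar-edge (suc k) k≡1))))

  φ : LieHom (CRel m) (DRel m)
  φ = substitutionHom image-respects-CRel

  φ-first : ∀ (i : Fin m) → toℕ i ≡ 0 →
    Eq (DRel m) (LieHom.map φ (gen i)) (half · (gen (just i) ⊕ gen nothing))
  φ-first zero _ = refl′

  φ-rest : ∀ (k : Fin m) → 1 ≤ toℕ k → Eq (DRel m) (LieHom.map φ (gen k)) (gen (just k))
  φ-rest (suc k) _ = refl′

-- The construction works for every rank.
lemma2p18 : ∀ {c ℓ : Level} (K : CommutativeRing c ℓ)
    (half : CommutativeRing.Carrier K) →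
    CommutativeRing._≈_ K (CommutativeRing._+_ K half half) (CommutativeRing.1# K) →
    (n : ℕ) → 1 ≤ n →
    Σ (Presented.LieHom K (Presented.CRel K (2 * n)) (Presented.DRel K (2 * n))) λ φ →
      (∀ (i : Fin (2 * n)) → toℕ i ≡ 0 →
        Presented.Eq K (Presented.DRel K (2 * n))
          (Presented.LieHom.map φ (Presented.Tm.gen i))
          (Presented._·_ half
            (Presented._⊕_ (Presented.Tm.gen (just i)) (Presented.Tm.gen nothing))))
      × (∀ (k : Fin (2 * n)) → 1 ≤ toℕ k →
        Presented.Eq K (Presented.DRel K (2 * n))
          (Presented.LieHom.map φ (Presented.Tm.gen k))
          (Presented.Tm.gen (just k)))
lemma2p18 K half half+half≈1 n _ = φ , φ-first , φ-rest
  where open Embedding K half half+half≈1 (2 * n)
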